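{- The rule $I_c$ (insertion of the double cut) is derivable in $ALFA_{Io}$: for every graph $A$, $A\vdash_{ALFA_{Io}}[[A]]$.
   Context: Graphs: the empty graph $\emptyset$ and propositional letters are graphs; if $G,H$ are graphs then so are the juxtaposition $GH$, the cut $[G]$ ($G$ inside a solid closed curve), the implication graph $\langle G\Rightarrow H\rangle$ (a solid closed curve containing $G$ and a dotted closed curve containing $H$), and the disjunction graph $\langle G\vee H\rangle$ (a solid closed curve containing two semi-dotted closed curves, one containing $G$ and one containing $H$; $\langle G\vee H\rangle=\langle H\vee G\rangle$). Juxtaposition is associative and commutative with unit $\emptyset$; $[\,]$ is the empty cut. Rules are schemata with $A,B,C$ arbitrary (possibly empty) graphs, applied to the whole graph on the sheet. The system $ALFA_{Io}$ has first-degree rules $MP_i: A\langle A\Rightarrow B\rangle\vdash B$; $I_\vee: A\vdash\langle A\vee B\rangle$; $R_2: AB\vdash A$; $I_{p3}:\langle A\vee B\rangle\vdash\langle[A]\Rightarrow B\rangle$; $I_{p2}: [AB]\vdash\langle A\Rightarrow[B]\rangle$; $E_p:\langle A\Rightarrow B\rangle\vdash[A[B]]$; and second-degree rules $R_{8i}$: if $AB\vdash C$ then $A\vdash\langle B\Rightarrow C\rangle$; $R_0$: if $A\vdash B$ and $A\vdash C$ then $A\vdash BC$; $E_\vee$: if $A\vdash C$ and $B\vdash C$ then $\langle A\vee B\rangle\vdash C$. $\vdash_{ALFA_{Io}}$ is the least transitive relation on graphs containing all instances of the first-degree rules and closed under the second-degree rules. -}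

module Defs where

open import Data.Nat using (ℕ)

data Graph : Set where
  ∅     : Graph
  letter : ℕ → Graph
  _·_   : Graph → Graph → Graph      -- juxtaposition  G H
  cut   : Graph → Graph              -- [G]
  _⇒_   : Graph → Graph → Graph
  _∨_   : Graph → Graph → Graph

infixr 6 _·_

data _≈_ : Graph → Graph → Set where
  ≈-refl  : ∀ {G} → G ≈ G
  ≈-sym   : ∀ {G H} → G ≈ H → H ≈ G
  ≈-trans : ∀ {G H K} → G ≈ H → H ≈ K → G ≈ K
  ·-assoc : ∀ {G H K} → ((G · H) · K) ≈ (G · (H · K))
  ·-comm  : ∀ {G H} → (G · H) ≈ (H · G)
  ·-unitˡ : ∀ {G} → (∅ · G) ≈ G
  ∨-comm  : ∀ {G H} → (G ∨ H) ≈ (H ∨ G)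
  ·-cong  : ∀ {G G' H H'} → G ≈ G' → H ≈ H' → (G · H) ≈ (G' · H')
  cut-cong : ∀ {G G'} → G ≈ G' → cut G ≈ cut G'
  ⇒-cong  : ∀ {G G' H H'} → G ≈ G' → H ≈ H' → (G ⇒ H) ≈ (G' ⇒ H')
  ∨-cong  : ∀ {G G' H H'} → G ≈ G' → H ≈ H' → (G ∨ H) ≈ (G' ∨ H')

-- Since graphs are taken up to ≈, identical graphs are inter-derivable.
infix 4 _⊢_
data _⊢_ : Graph → Graph → Set where
  ≈-conv : ∀ {A B} → A ≈ B → A ⊢ B
  trans⊢ : ∀ {A B C} → A ⊢ B → B ⊢ C → A ⊢ C
  MPᵢ : ∀ {A B} → (A · (A ⇒ B)) ⊢ B
  I∨  : ∀ {A B} → A ⊢ (A ∨ B)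
  R₂  : ∀ {A B} → (A · B) ⊢ A
  Ip3 : ∀ {A B} → (A ∨ B) ⊢ (cut A ⇒ B)
  Ip2 : ∀ {A B} → cut (A · B) ⊢ (A ⇒ cut B)
  Ep  : ∀ {A B} → (A ⇒ B) ⊢ cut (A · cut B)
  R8ᵢ : ∀ {A B C} → (A · B) ⊢ C → A ⊢ (B ⇒ C)
  R₀  : ∀ {A B C} → A ⊢ B → A ⊢ C → A ⊢ (B · C)
  E∨  : ∀ {A B C} → A ⊢ C → B ⊢ C → (A ∨ B) ⊢ C

module Submission where

open import Defs

⊢∅⇒ : ∀ {A} → A ⊢ (∅ ⇒ A)
⊢∅⇒ = R8ᵢ R₂

mainTheorem13 : (A : Graph) → A ⊢ cut (cut A)
mainTheorem13 A = trans⊢ ⊢∅⇒ (trans⊢ Ep (≈-conv (cut-cong ·-unitˡ)))
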